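{- Let $N\ge1$, $\aleph_N=\{0,1,\dots,2^N-1\}$ and let $\pi$ be a permutation of $\aleph_N$. Then there is a semiring endomorphism $\tau$ of $S_c[X]$ such that $\tau(\overline{(y_i^{(N)},N)})=\overline{(y_{\pi(i)}^{(N)},N)}$ for all $i\in\aleph_N$.
   Context: A semiring is a set with operations $\circ$ (commutative monoid, identity $\theta$) and $\cdot$ (monoid, identity $1$), $\cdot$ distributing over $\circ$ on both sides, $\theta$ absorbing for $\cdot$, $1\ne\theta$. Let $X=\{x_1,x_2,\dots\}$ be countable. For $N\ge1$ let $S_c[X_N]$ be the quotient of the free commutative semiring on $\{x_1,\dots,x_N,x_1^c,\dots,x_N^c\}$ by the congruence generated by $(x_i\cdot x_i^c,\theta)$, $(x_i\circ x_i^c,1)$, $(x_i\circ x_i,x_i)$, $(x_i^c\circ x_i^c,x_i^c)$, $1\le i\le N$. For $k=\sum_{l=1}^N j_l2^{l-1}$, $j_l\in\{0,1\}$, put $y_k^{(N)}=x_1^{j_1}\cdots x_N^{j_N}$ with $x_l^1=x_l$, $x_l^0=x_l^c$; every element of $S_c[X_N]$ is uniquely $\sum^\circ_{k\in D}y_k^{(N)}$ with $D\subseteq\aleph_N$ ($D=\emptyset$ gives $\theta$, $D=\aleph_N$ gives $1$). For $N\le M$ let $f_{NM}:S_c[X_N]\to S_c[X_M]$ be the homomorphism induced by $x_i\mapsto x_i,x_i^c\mapsto x_i^c$. $S_c[X]$ is the direct limit: classes $\overline{(a,i)}$ of pairs $a\in S_c[X_i]$, with $(a,i)\sim(b,j)$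 iff $f_{ik}(a)=f_{jk}(b)$ for some $k\ge i,j$, and operations $\overline{(a,i)}\diamond\overline{(b,j)}=\overline{(f_{ik}(a)\diamond f_{jk}(b),k)}$ for $\diamond\in\{\circ,\cdot\}$, $k\ge i,j$. -}

module Defs where

open import Level using (0ℓ)
open import Data.Nat using (ℕ; zero; suc; _≤_; _⊔_; _^_; _/_; _%_)
open import Data.Nat.Properties using (m≤m⊔n; m≤n⊔m)
open import Data.Fin using (Fin; toℕ; inject≤)
open import Data.List using (foldr; allFin)
open import Data.Product using (Σ; ∃; _×_; _,_)
open import Algebra.Bundles.Raw using (RawSemiring)

infixl 6 _∘_
infixl 7 _·_

-- Terms over the generators x_1..x_N, x_1^c..x_N^c (indices shifted to Fin N).
data Term (N : ℕ) : Set where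
  x  : Fin N → Term N
  xc : Fin N → Term N
  θ  : Term N
  𝟙  : Term N
  _∘_ : Term N → Term N → Term N
  _·_ : Term N → Term N → Term N

infix 4 _≈_
-- The congruence on terms: commutative-semiring axioms (giving the free
-- commutative semiring) together with the generating pairs of S_c[X_N].
data _≈_ {N : ℕ} : Term N → Term N → Set where
  ≈-refl  : ∀ {a} → a ≈ a
  ≈-sym   : ∀ {a b} → a ≈ b → b ≈ a
  ≈-trans : ∀ {a b c} → a ≈ b → b ≈ c → a ≈ c
  ∘-cong  : ∀ {a a′ b b′} → a ≈ a′ → b ≈ b′ → a ∘ b ≈ a′ ∘ b′
  ·-cong  : ∀ {a a′ b b′} → a ≈ a′ → b ≈ b′ → a · b ≈ a′ · b′
  ∘-assoc : ∀ a b c → (a ∘ b) ∘ c ≈ a ∘ (b ∘ c)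
  ∘-comm  : ∀ a b → a ∘ b ≈ b ∘ a
  ∘-idˡ   : ∀ a → θ ∘ a ≈ a
  ·-assoc : ∀ a b c → (a · b) · c ≈ a · (b · c)
  ·-comm  : ∀ a b → a · b ≈ b · a
  ·-idˡ   : ∀ a → 𝟙 · a ≈ a
  distribˡ : ∀ a b c → a · (b ∘ c) ≈ (a · b) ∘ (a · c)
  zeroˡ   : ∀ a → θ · a ≈ θ
  rel-·c  : ∀ i → x i · xc i ≈ θ
  rel-∘c  : ∀ i → x i ∘ xc i ≈ 𝟙
  rel-idem  : ∀ i → x i ∘ x i ≈ x i
  rel-idemc : ∀ i → xc i ∘ xc i ≈ xc i

f : ∀ {N M} → N ≤ M → Term N → Term M
f p (x i)   = x (inject≤ i p)
f p (xc i)  = xc (inject≤ i p)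
f p θ       = θ
f p 𝟙       = 𝟙
f p (a ∘ b) = f p a ∘ f p b
f p (a · b) = f p a · f p b

-- The bit j_{l+1} of k (l = 0..N-1).
-- bit k l = ⌊k / 2^l⌋ mod 2
bit : ℕ → ℕ → ℕ
bit k zero    = k % 2
bit k (suc l) = bit (k / 2) l

y : (N : ℕ) → Fin (2 ^ N) → Term N
y N k = foldr (λ l t → lit l · t) 𝟙 (allFin N)
  where
  lit : Fin N → Term N
  lit l with bit (toℕ k) (toℕ l)
  ... | 0 = xc l
  ... | _ = x l

-- S_c[X] as the direct limit: pairs (i , a) with a ∈ S_c[X_i].
ScX : Set
ScX = Σ ℕ Term

infix 4 _~_
_~_ : ScX → ScX → Set
(i , a) ~ (j , b) = ∃ λ k → Σ (i ≤ k) λ p → Σ (j ≤ k) λ q → f p a ≈ f q b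

_∘ₗ_ : ScX → ScX → ScX
(i , a) ∘ₗ (j , b) = (i ⊔ j) , (f (m≤m⊔n i j) a ∘ f (m≤n⊔m i j) b)

_·ₗ_ : ScX → ScX → ScX
(i , a) ·ₗ (j , b) = (i ⊔ j) , (f (m≤m⊔n i j) a · f (m≤n⊔m i j) b)

ScX-raw : RawSemiring 0ℓ 0ℓ
ScX-raw = record
  { Carrier = ScX
  ; _≈_ = _~_
  ; _+_ = _∘ₗ_
  ; _*_ = _·ₗ_
  ; 0# = 1 , θ
  ; 1# = 1 , 𝟙
  }

{-# OPTIONS --safe #-}

-- S_c[X] is the algebra of Boolean functions of finitely many of the variables x₁, x₂, …:
-- a term denotes a function of an assignment ρ : ℕ → Bool, and two terms with at least one
-- variable are congruent iff they denote the same function (Shannon expansion on x₁ yields a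
-- normal form).  The element y_k^{(N)} denotes the indicator of the assignments whose first N
-- values are the binary digits of k.  Hence every map h on assignments that, for all M ≥ N,
-- preserves agreement on the first M variables induces an endomorphism a ↦ a ∘ h.  Take for h
-- the map replacing the first N values of ρ, the digits of some k, by the digits of π⁻¹(k):
-- then y_i ∘ h = y_{π(i)}.

module Submission where

open import Defs
open import Data.Nat using (ℕ; _≤_; _^_)
open import Data.Fin using (Fin)
open import Data.Fin.Permutation using (Permutation′; _⟨$⟩ʳ_)
open import Data.Product using (∃; _×_; _,_)
open import Algebra.Morphism.Structures using (module SemiringMorphisms)
open SemiringMorphisms ScX-raw ScX-raw using (IsSemiringHomomorphism)

open import Level using (0ℓ)
open import Algebra.Bundles using (CommutativeSemiring)
open import Algebra.Consequences.Setoid using (comm∧distrˡ⇒distrʳ)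
open import Algebra.Structures.Biased using (isCommutativeSemiringˡ; isCommutativeMonoidˡ)
import Algebra.Solver.Ring.NaturalCoefficients.Default as CommutativeSemiringSolver
open import Data.Bool using (Bool; true; false; not; _∧_; _∨_; if_then_else_)
open import Data.Bool.Properties
  using (∨-assoc; ∨-comm; ∧-assoc; ∧-comm; ∧-distribˡ-∨; ∧-inverseʳ; ∨-inverseʳ; ∨-idem; ∨-identityʳ;
         ∧-conicalˡ; ∧-conicalʳ; ⇔→≡)
open import Data.Nat using (zero; suc; _<_; _⊔_; s≤s; z≤n; _<ᵇ_)
open import Data.Nat.Properties using (≤-trans; m≤m⊔n; m≤n⊔m; n≤1+n; <⇒<ᵇ)
open import Data.Fin using (toℕ; fromℕ<) renaming (zero to fzero; suc to fsuc)
open import Data.Fin.Properties using (toℕ<n; toℕ-inject≤; toℕ-fromℕ<; fromℕ<-cong; toℕ-injective)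
open import Data.Fin.Permutation using (_⟨$⟩ˡ_)
open import Data.List using (List; []; _∷_; foldr; allFin)
open import Data.List.Properties using (foldr-cong)
open import Data.List.Relation.Unary.All using (All; []; _∷_)
open import Data.List.Relation.Unary.All.Properties using (tabulate⁺; tabulate⁻)
open import Data.Product using (Σ; proj₁)
open import Function using (const; _∘′_)
open import Function.Bundles using (_⇔_; mk⇔; Equivalence; Inverse)
open import Function.Properties.Equivalence using (⇔-setoid) renaming (sym to ⇔-sym; trans to ⇔-trans)
open import Relation.Binary using (IsEquivalence; Setoid)
open import Relation.Binary.PropositionalEquality
  using (_≡_; _≗_; refl; sym; trans; cong; cong₂; subst; module ≡-Reasoning)

private variable
  N M : ℕ

module Complementary {c ℓ} (R : CommutativeSemiring c ℓ) where
  open CommutativeSemiring R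
    using (Carrier; setoid; _+_; _*_; 0#; 1#; +-cong; +-congˡ; *-congˡ; *-congʳ; +-comm; *-comm)
    renaming (_≈_ to _≃_; refl to ≃-refl; trans to ≃-trans)
  open CommutativeSemiringSolver R using (solve; _:=_; _:+_; _:*_; con)
  open import Relation.Binary.Reasoning.Setoid setoid

  idempotent : ∀ {p q} → p * q ≃ 0# → p + q ≃ 1# → p * p ≃ p
  idempotent {p} {q} p*q≈0 p+q≈1 = begin
    p * p           ≈⟨ solve 2 (λ p q → p :* p := p :* p :+ con 0) ≃-refl p q ⟩
    p * p + 0#      ≈⟨ +-congˡ p*q≈0 ⟨
    p * p + p * q   ≈⟨ solve 2 (λ p q → p :* p :+ p :* q := p :* (p :+ q)) ≃-refl p q ⟩
    p * (p + q)     ≈⟨ *-congˡ p+q≈1 ⟩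
    p * 1#          ≈⟨ solve 1 (λ p → p :* con 1 := p) ≃-refl p ⟩
    p               ∎

  module Split {p q : Carrier} (p*q≈0 : p * q ≃ 0#) (p+q≈1 : p + q ≃ 1#) where

    split : ∀ v → v ≃ p * v + q * v
    split v = begin
      v             ≈⟨ solve 1 (λ v → v := con 1 :* v) ≃-refl v ⟩
      1# * v        ≈⟨ *-congʳ p+q≈1 ⟨
      (p + q) * v   ≈⟨ solve 3 (λ p q v → (p :+ q) :* v := p :* v :+ q :* v) ≃-refl p q v ⟩
      p * v + q * v ∎

    p-split : p ≃ p * 1# + q * 0#
    p-split = solve 2 (λ p q → p := p :* con 1 :+ q :* con 0) ≃-refl p q

    q-split : q ≃ p * 0# + q * 1#
    q-split = solve 2 (λ p q → q := p :* con 0 :+ q :* con 1) ≃-refl p q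

    +-split : ∀ a b c d → (p * a + q * b) + (p * c + q * d) ≃ p * (a + c) + q * (b + d)
    +-split = solve 6 (λ p q a b c d → (p :* a :+ q :* b) :+ (p :* c :+ q :* d)
                                      := p :* (a :+ c) :+ q :* (b :+ d)) ≃-refl p q

    *-split : ∀ a b c d → (p * a + q * b) * (p * c + q * d) ≃ p * (a * c) + q * (b * d)
    *-split a b c d = begin
      (p * a + q * b) * (p * c + q * d)
        ≈⟨ solve 6 (λ p q a b c d → (p :* a :+ q :* b) :* (p :* c :+ q :* d)
                      := (p :* p) :* (a :* c) :+ (q :* q) :* (b :* d) :+ (p :* q) :* (a :* d :+ b :* c))
                   ≃-refl p q a b c d ⟩
      (p * p) * (a * c) + (q * q) * (b * d) + (p * q) * (a * d + b * c)
        ≈⟨ +-cong (+-cong (*-congʳ p*p≈p) (*-congʳ q*q≈q)) (*-congʳ p*q≈0) ⟩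
      p * (a * c) + q * (b * d) + 0# * (a * d + b * c)
        ≈⟨ solve 5 (λ p q u w z → p :* u :+ q :* w :+ con 0 :* z := p :* u :+ q :* w)
                   ≃-refl p q (a * c) (b * d) (a * d + b * c) ⟩
      p * (a * c) + q * (b * d) ∎
      where
      p*p≈p : p * p ≃ p
      p*p≈p = idempotent p*q≈0 p+q≈1
      q*q≈q : q * q ≃ q
      q*q≈q = idempotent (≃-trans (*-comm q p) p*q≈0) (≃-trans (+-comm q p) p+q≈1)

≈-isEquivalence : IsEquivalence (_≈_ {N})
≈-isEquivalence = record { refl = ≈-refl ; sym = ≈-sym ; trans = ≈-trans }

≈-reflexive : {a b : Term N} → a ≡ b → a ≈ b
≈-reflexive = IsEquivalence.reflexive ≈-isEquivalence

≈-setoid : ℕ → Setoid 0ℓ 0ℓ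
≈-setoid N = record { isEquivalence = ≈-isEquivalence {N} }

termSemiring : ℕ → CommutativeSemiring 0ℓ 0ℓ
termSemiring N = record
  { Carrier = Term N
  ; _≈_ = _≈_
  ; _+_ = _∘_
  ; _*_ = _·_
  ; 0# = θ
  ; 1# = 𝟙
  ; isCommutativeSemiring = isCommutativeSemiringˡ record
    { +-isCommutativeMonoid = isCommutativeMonoidˡ record
      { isSemigroup = record { isMagma = record { isEquivalence = ≈-isEquivalence ; ∙-cong = ∘-cong }
                             ; assoc = ∘-assoc }
      ; identityˡ = ∘-idˡ
      ; comm = ∘-comm
      }
    ; *-isCommutativeMonoid = isCommutativeMonoidˡ record
      { isSemigroup = record { isMagma = record { isEquivalence = ≈-isEquivalence ; ∙-cong = ·-cong }
                             ; assoc = ·-assoc }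
      ; identityˡ = ·-idˡ
      ; comm = ·-comm
      }
    ; distribʳ = comm∧distrˡ⇒distrʳ (≈-setoid N) ∘-cong ·-comm distribˡ
    ; zeroˡ = zeroˡ
    }
  }

-- Boolean semantics

Env : Set
Env = ℕ → Bool

Agree : ℕ → Env → Env → Set
Agree M ρ ρ′ = ∀ {n} → n < M → ρ n ≡ ρ′ n

DependsOnFirst : ℕ → (Env → Bool) → Set
DependsOnFirst M g = ∀ {ρ ρ′} → Agree M ρ ρ′ → g ρ ≡ g ρ′

Agree⇔∀Fin : ∀ {ρ ρ′} → Agree N ρ ρ′ ⇔ (∀ (l : Fin N) → ρ (toℕ l) ≡ ρ′ (toℕ l))
Agree⇔∀Fin {ρ = ρ} {ρ′} = mk⇔
  (λ (ρ≐ρ′ : Agree _ ρ ρ′) l → ρ≐ρ′ (toℕ<n l))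
  (λ ρ≐ρ′ {n} n<N → subst (λ n → ρ n ≡ ρ′ n) (toℕ-fromℕ< n<N) (ρ≐ρ′ (fromℕ< n<N)))

Agree-≤ : ∀ {ρ ρ′} → M ≤ N → Agree N ρ ρ′ → Agree M ρ ρ′
Agree-≤ M≤N ρ≐ρ′ n<M = ρ≐ρ′ (≤-trans n<M M≤N)

⟦_⟧ : Term N → Env → Bool
⟦ x i ⟧   ρ = ρ (toℕ i)
⟦ xc i ⟧  ρ = not (ρ (toℕ i))
⟦ θ ⟧     ρ = false
⟦ 𝟙 ⟧     ρ = true
⟦ a ∘ b ⟧ ρ = ⟦ a ⟧ ρ ∨ ⟦ b ⟧ ρ
⟦ a · b ⟧ ρ = ⟦ a ⟧ ρ ∧ ⟦ b ⟧ ρ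

⟦⟧-local : (a : Term N) → DependsOnFirst N ⟦ a ⟧
⟦⟧-local (x i)   ρ≐ρ′ = ρ≐ρ′ (toℕ<n i)
⟦⟧-local (xc i)  ρ≐ρ′ = cong not (ρ≐ρ′ (toℕ<n i))
⟦⟧-local θ       ρ≐ρ′ = refl
⟦⟧-local 𝟙       ρ≐ρ′ = refl
⟦⟧-local (a ∘ b) ρ≐ρ′ = cong₂ _∨_ (⟦⟧-local a ρ≐ρ′) (⟦⟧-local b ρ≐ρ′)
⟦⟧-local (a · b) ρ≐ρ′ = cong₂ _∧_ (⟦⟧-local a ρ≐ρ′) (⟦⟧-local b ρ≐ρ′)

≈⇒≗ : {a b : Term N} → a ≈ b → ⟦ a ⟧ ≗ ⟦ b ⟧
≈⇒≗ ≈-refl            ρ = refl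
≈⇒≗ (≈-sym p)         ρ = sym (≈⇒≗ p ρ)
≈⇒≗ (≈-trans p q)     ρ = trans (≈⇒≗ p ρ) (≈⇒≗ q ρ)
≈⇒≗ (∘-cong p q)      ρ = cong₂ _∨_ (≈⇒≗ p ρ) (≈⇒≗ q ρ)
≈⇒≗ (·-cong p q)      ρ = cong₂ _∧_ (≈⇒≗ p ρ) (≈⇒≗ q ρ)
≈⇒≗ (∘-assoc a b c)   ρ = ∨-assoc (⟦ a ⟧ ρ) _ _
≈⇒≗ (∘-comm a b)      ρ = ∨-comm (⟦ a ⟧ ρ) _
≈⇒≗ (∘-idˡ a)         ρ = refl
≈⇒≗ (·-assoc a b c)   ρ = ∧-assoc (⟦ a ⟧ ρ) _ _
≈⇒≗ (·-comm a b)      ρ = ∧-comm (⟦ a ⟧ ρ) _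
≈⇒≗ (·-idˡ a)         ρ = refl
≈⇒≗ (distribˡ a b c)  ρ = ∧-distribˡ-∨ (⟦ a ⟧ ρ) _ _
≈⇒≗ (zeroˡ a)         ρ = refl
≈⇒≗ (rel-·c i)        ρ = ∧-inverseʳ (ρ (toℕ i))
≈⇒≗ (rel-∘c i)        ρ = ∨-inverseʳ (ρ (toℕ i))
≈⇒≗ (rel-idem i)      ρ = ∨-idem _
≈⇒≗ (rel-idemc i)     ρ = ∨-idem _

⟦f⟧ : (p : N ≤ M) (a : Term N) → ⟦ f p a ⟧ ≗ ⟦ a ⟧
⟦f⟧ p (x i)   ρ = cong ρ (toℕ-inject≤ i p)
⟦f⟧ p (xc i)  ρ = cong (not ∘′ ρ) (toℕ-inject≤ i p)
⟦f⟧ p θ       ρ = refl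
⟦f⟧ p 𝟙       ρ = refl
⟦f⟧ p (a ∘ b) ρ = cong₂ _∨_ (⟦f⟧ p a ρ) (⟦f⟧ p b ρ)
⟦f⟧ p (a · b) ρ = cong₂ _∧_ (⟦f⟧ p a ρ) (⟦f⟧ p b ρ)

-- Shannon normal form and completeness

wk : Term N → Term (suc N)
wk (x i)   = x (fsuc i)
wk (xc i)  = xc (fsuc i)
wk θ       = θ
wk 𝟙       = 𝟙
wk (a ∘ b) = wk a ∘ wk b
wk (a · b) = wk a · wk b

wk-cong : {a b : Term N} → a ≈ b → wk a ≈ wk b
wk-cong ≈-refl           = ≈-refl
wk-cong (≈-sym p)        = ≈-sym (wk-cong p)
wk-cong (≈-trans p q)    = ≈-trans (wk-cong p) (wk-cong q)
wk-cong (∘-cong p q)     = ∘-cong (wk-cong p) (wk-cong q)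
wk-cong (·-cong p q)     = ·-cong (wk-cong p) (wk-cong q)
wk-cong (∘-assoc a b c)  = ∘-assoc _ _ _
wk-cong (∘-comm a b)     = ∘-comm _ _
wk-cong (∘-idˡ a)        = ∘-idˡ _
wk-cong (·-assoc a b c)  = ·-assoc _ _ _
wk-cong (·-comm a b)     = ·-comm _ _
wk-cong (·-idˡ a)        = ·-idˡ _
wk-cong (distribˡ a b c) = distribˡ _ _ _
wk-cong (zeroˡ a)        = zeroˡ _
wk-cong (rel-·c i)       = rel-·c _
wk-cong (rel-∘c i)       = rel-∘c _
wk-cong (rel-idem i)     = rel-idem _
wk-cong (rel-idemc i)    = rel-idemc _

⟦wk⟧ : (a : Term N) (ρ : Env) → ⟦ wk a ⟧ ρ ≡ ⟦ a ⟧ (ρ ∘′ suc)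
⟦wk⟧ (x i)   ρ = refl
⟦wk⟧ (xc i)  ρ = refl
⟦wk⟧ θ       ρ = refl
⟦wk⟧ 𝟙       ρ = refl
⟦wk⟧ (a ∘ b) ρ = cong₂ _∨_ (⟦wk⟧ a ρ) (⟦wk⟧ b ρ)
⟦wk⟧ (a · b) ρ = cong₂ _∧_ (⟦wk⟧ a ρ) (⟦wk⟧ b ρ)

constant : Bool → Term N
constant true  = 𝟙
constant false = θ

⟦constant⟧ : ∀ b {ρ} → ⟦ constant {N} b ⟧ ρ ≡ b
⟦constant⟧ true  = refl
⟦constant⟧ false = refl

wk-constant : ∀ b → wk (constant {N} b) ≡ constant b
wk-constant true  = refl
wk-constant false = refl

-- Term 0 is the free commutative semiring ℕ, where 𝟙 ∘ 𝟙 ≉ 𝟙: idempotence of ∘ needs a variable.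
𝟙∘𝟙≈𝟙 : 𝟙 ∘ 𝟙 ≈ 𝟙 {suc N}
𝟙∘𝟙≈𝟙 {N} = begin
  𝟙 ∘ 𝟙                     ≈⟨ ∘-cong (rel-∘c fzero) (rel-∘c fzero) ⟨
  (x₀ ∘ xc₀) ∘ (x₀ ∘ xc₀)   ≈⟨ solve 2 (λ p q → (p :+ q) :+ (p :+ q) := (p :+ p) :+ (q :+ q)) ≈-refl x₀ xc₀ ⟩
  (x₀ ∘ x₀) ∘ (xc₀ ∘ xc₀)   ≈⟨ ∘-cong (rel-idem fzero) (rel-idemc fzero) ⟩
  x₀ ∘ xc₀                  ≈⟨ rel-∘c fzero ⟩
  𝟙                         ∎
  where
  open CommutativeSemiringSolver (termSemiring (suc N)) using (solve; _:=_; _:+_)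
  open import Relation.Binary.Reasoning.Setoid (≈-setoid (suc N))
  x₀ xc₀ : Term (suc N)
  x₀  = x fzero
  xc₀ = xc fzero

constant-∨ : ∀ a b → constant {suc N} a ∘ constant b ≈ constant (a ∨ b)
constant-∨ true  true  = 𝟙∘𝟙≈𝟙
constant-∨ true  false = ≈-trans (∘-comm 𝟙 θ) (∘-idˡ 𝟙)
constant-∨ false b     = ∘-idˡ _

constant-∧ : ∀ a b → constant {N} a · constant b ≈ constant (a ∧ b)
constant-∧ true  b = ·-idˡ _
constant-∧ false b = zeroˡ _

wk-closed : (s : Term 0) {ρ : Env} → wk s ≈ constant (⟦ s ⟧ ρ)
wk-closed θ       = ≈-refl
wk-closed 𝟙       = ≈-refl
wk-closed (a ∘ b) = ≈-trans (∘-cong (wk-closed a) (wk-closed b)) (constant-∨ _ _)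
wk-closed (a · b) = ≈-trans (·-cong (wk-closed a) (wk-closed b)) (constant-∧ _ _)

infixr 5 _∷ᵉ_
_∷ᵉ_ : Bool → Env → Env
(b ∷ᵉ ρ) zero    = b
(b ∷ᵉ ρ) (suc n) = ρ n

Agree-∷ᵉ : ∀ b {ρ ρ′} → Agree M ρ ρ′ → Agree (suc M) (b ∷ᵉ ρ) (b ∷ᵉ ρ′)
Agree-∷ᵉ b ρ≐ρ′ {zero}  _         = refl
Agree-∷ᵉ b ρ≐ρ′ {suc n} (s≤s n<M) = ρ≐ρ′ n<M

∷ᵉ-η : ∀ ρ → Agree M (ρ 0 ∷ᵉ ρ ∘′ suc) ρ
∷ᵉ-η ρ {zero}  _ = refl
∷ᵉ-η ρ {suc n} _ = refl

subst₀ : Bool → Term (suc N) → Term N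
subst₀ b (x fzero)     = constant b
subst₀ b (x (fsuc i))  = x i
subst₀ b (xc fzero)    = constant (not b)
subst₀ b (xc (fsuc i)) = xc i
subst₀ b θ             = θ
subst₀ b 𝟙             = 𝟙
subst₀ b (s ∘ t)       = subst₀ b s ∘ subst₀ b t
subst₀ b (s · t)       = subst₀ b s · subst₀ b t

⟦subst₀⟧ : ∀ b (a : Term (suc N)) → ⟦ subst₀ b a ⟧ ≗ ⟦ a ⟧ ∘′ (b ∷ᵉ_)
⟦subst₀⟧ b (x fzero)     ρ = ⟦constant⟧ b
⟦subst₀⟧ b (x (fsuc i))  ρ = refl
⟦subst₀⟧ b (xc fzero)    ρ = ⟦constant⟧ (not b)
⟦subst₀⟧ b (xc (fsuc i)) ρ = refl
⟦subst₀⟧ b θ             ρ = refl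
⟦subst₀⟧ b 𝟙             ρ = refl
⟦subst₀⟧ b (s ∘ t)       ρ = cong₂ _∨_ (⟦subst₀⟧ b s ρ) (⟦subst₀⟧ b t ρ)
⟦subst₀⟧ b (s · t)       ρ = cong₂ _∧_ (⟦subst₀⟧ b s ρ) (⟦subst₀⟧ b t ρ)

module _ {N : ℕ} where
  open Complementary.Split (termSemiring (suc N)) (rel-·c fzero) (rel-∘c fzero)

  shannon : (t : Term (suc N)) → t ≈ (x fzero · wk (subst₀ true t)) ∘ (xc fzero · wk (subst₀ false t))
  shannon (x fzero)     = p-split
  shannon (xc fzero)    = q-split
  shannon (x (fsuc i))  = split _
  shannon (xc (fsuc i)) = split _
  shannon θ             = split _
  shannon 𝟙             = split _
  shannon (a ∘ b)       = ≈-trans (∘-cong (shannon a) (shannon b)) (+-split _ _ _ _)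
  shannon (a · b)       = ≈-trans (·-cong (shannon a) (shannon b)) (*-split _ _ _ _)

shannonᴮ : ∀ b (F : Bool → Bool) → (b ∧ F true) ∨ (not b ∧ F false) ≡ F b
shannonᴮ true  F = ∨-identityʳ (F true)
shannonᴮ false F = refl

nf : (M : ℕ) → (Env → Bool) → Term M
nf zero    g = constant (g (const false))
nf (suc M) g = (x fzero · wk (nf M (g ∘′ (true ∷ᵉ_)))) ∘ (xc fzero · wk (nf M (g ∘′ (false ∷ᵉ_))))

nf-cong : ∀ M {g g′} → g ≗ g′ → nf M g ≡ nf M g′
nf-cong zero    g≗g′ = cong constant (g≗g′ _)
nf-cong (suc M) g≗g′ = cong₂ (λ u v → (x fzero · wk u) ∘ (xc fzero · wk v))
                             (nf-cong M (λ ρ → g≗g′ (true ∷ᵉ ρ)))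
                             (nf-cong M (λ ρ → g≗g′ (false ∷ᵉ ρ)))

⟦nf⟧ : ∀ M {g} → DependsOnFirst M g → ⟦ nf M g ⟧ ≗ g
⟦nf⟧ zero    {g} g-local ρ = trans (⟦constant⟧ _) (g-local λ ())
⟦nf⟧ (suc M) {g} g-local ρ = begin
  (ρ 0 ∧ ⟦ wk (nf M (g ∘′ (true ∷ᵉ_))) ⟧ ρ) ∨ (not (ρ 0) ∧ ⟦ wk (nf M (g ∘′ (false ∷ᵉ_))) ⟧ ρ)
    ≡⟨ cong₂ (λ u v → (ρ 0 ∧ u) ∨ (not (ρ 0) ∧ v)) (branch true) (branch false) ⟩
  (ρ 0 ∧ g (true ∷ᵉ ρ ∘′ suc)) ∨ (not (ρ 0) ∧ g (false ∷ᵉ ρ ∘′ suc))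
    ≡⟨ shannonᴮ (ρ 0) (λ b → g (b ∷ᵉ ρ ∘′ suc)) ⟩
  g (ρ 0 ∷ᵉ ρ ∘′ suc)
    ≡⟨ g-local (∷ᵉ-η ρ) ⟩
  g ρ ∎
  where
  open ≡-Reasoning
  branch : ∀ b → ⟦ wk (nf M (g ∘′ (b ∷ᵉ_))) ⟧ ρ ≡ g (b ∷ᵉ ρ ∘′ suc)
  branch b = trans (⟦wk⟧ (nf M (g ∘′ (b ∷ᵉ_))) ρ) (⟦nf⟧ M (g-local ∘′ Agree-∷ᵉ b) (ρ ∘′ suc))

mutual
  wk-nf : ∀ N (s : Term N) → wk s ≈ wk (nf N ⟦ s ⟧)
  wk-nf zero    s = ≈-trans (wk-closed s) (≈-reflexive (sym (wk-constant _)))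
  wk-nf (suc N) s = wk-cong (nf-complete s)

  nf-complete : (t : Term (suc N)) → t ≈ nf (suc N) ⟦ t ⟧
  nf-complete {N} t =
    ≈-trans (shannon t) (∘-cong (·-cong ≈-refl (branch true)) (·-cong ≈-refl (branch false)))
    where
    branch : ∀ b → wk (subst₀ b t) ≈ wk (nf N (⟦ t ⟧ ∘′ (b ∷ᵉ_)))
    branch b = ≈-trans (wk-nf N (subst₀ b t)) (≈-reflexive (cong wk (nf-cong N (⟦subst₀⟧ b t))))

≗⇒≈ : (s t : Term (suc N)) → ⟦ s ⟧ ≗ ⟦ t ⟧ → s ≈ t
≗⇒≈ {N} s t s≗t =
  ≈-trans (nf-complete s) (≈-trans (≈-reflexive (nf-cong (suc N) s≗t)) (≈-sym (nf-complete t)))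

-- The direct limit

⟦_⟧ₗ : ScX → Env → Bool
⟦ _ , a ⟧ₗ = ⟦ a ⟧

~⇒≗ : ∀ {A B} → A ~ B → ⟦ A ⟧ₗ ≗ ⟦ B ⟧ₗ
~⇒≗ {_ , a} {_ , b} (_ , p , q , fa≈fb) ρ =
  trans (sym (⟦f⟧ p a ρ)) (trans (≈⇒≗ fa≈fb ρ) (⟦f⟧ q b ρ))

-- The extra variable in suc (i ⊔ j) makes ≗⇒≈ applicable (see 𝟙∘𝟙≈𝟙).
≗⇒~ : ∀ {A B} → ⟦ A ⟧ₗ ≗ ⟦ B ⟧ₗ → A ~ B
≗⇒~ {i , a} {j , b} a≗b = suc (i ⊔ j) , p , q ,
  ≗⇒≈ (f p a) (f q b) (λ ρ → trans (⟦f⟧ p a ρ) (trans (a≗b ρ) (sym (⟦f⟧ q b ρ))))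
  where
  p : i ≤ suc (i ⊔ j)
  p = ≤-trans (m≤m⊔n i j) (n≤1+n _)
  q : j ≤ suc (i ⊔ j)
  q = ≤-trans (m≤n⊔m i j) (n≤1+n _)

⟦∘ₗ⟧ : ∀ A B ρ → ⟦ A ∘ₗ B ⟧ₗ ρ ≡ ⟦ A ⟧ₗ ρ ∨ ⟦ B ⟧ₗ ρ
⟦∘ₗ⟧ (_ , a) (_ , b) ρ = cong₂ _∨_ (⟦f⟧ _ a ρ) (⟦f⟧ _ b ρ)

⟦·ₗ⟧ : ∀ A B ρ → ⟦ A ·ₗ B ⟧ₗ ρ ≡ ⟦ A ⟧ₗ ρ ∧ ⟦ B ⟧ₗ ρ
⟦·ₗ⟧ (_ , a) (_ , b) ρ = cong₂ _∧_ (⟦f⟧ _ a ρ) (⟦f⟧ _ b ρ)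

module Pullback (N : ℕ) (h : Env → Env)
                (h-local : ∀ {M ρ ρ′} → N ≤ M → Agree M ρ ρ′ → Agree M (h ρ) (h ρ′)) where

  τ : ScX → ScX
  τ (i , a) = i ⊔ N , nf (i ⊔ N) (⟦ a ⟧ ∘′ h)

  ⟦τ⟧ : ∀ A → ⟦ τ A ⟧ₗ ≗ ⟦ A ⟧ₗ ∘′ h
  ⟦τ⟧ (i , a) = ⟦nf⟧ (i ⊔ N) (⟦⟧-local a ∘′ Agree-≤ (m≤m⊔n i N) ∘′ h-local (m≤n⊔m i N))

  τ-homo : ∀ (_⊕_ : ScX → ScX → ScX) (_⊕ᴮ_ : Bool → Bool → Bool) →
           (∀ A B ρ → ⟦ A ⊕ B ⟧ₗ ρ ≡ ⟦ A ⟧ₗ ρ ⊕ᴮ ⟦ B ⟧ₗ ρ) → ∀ A B → τ (A ⊕ B) ~ τ A ⊕ τ B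
  τ-homo _⊕_ _⊕ᴮ_ ⟦⊕⟧ A B = ≗⇒~ λ ρ → begin
    ⟦ τ (A ⊕ B) ⟧ₗ ρ               ≡⟨ ⟦τ⟧ (A ⊕ B) ρ ⟩
    ⟦ A ⊕ B ⟧ₗ (h ρ)               ≡⟨ ⟦⊕⟧ A B (h ρ) ⟩
    ⟦ A ⟧ₗ (h ρ) ⊕ᴮ ⟦ B ⟧ₗ (h ρ)   ≡⟨ cong₂ _⊕ᴮ_ (⟦τ⟧ A ρ) (⟦τ⟧ B ρ) ⟨
    ⟦ τ A ⟧ₗ ρ ⊕ᴮ ⟦ τ B ⟧ₗ ρ       ≡⟨ ⟦⊕⟧ (τ A) (τ B) ρ ⟨
    ⟦ τ A ⊕ τ B ⟧ₗ ρ               ∎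
    where open ≡-Reasoning

  τ-isSemiringHomomorphism : IsSemiringHomomorphism τ
  τ-isSemiringHomomorphism = record
    { isNearSemiringHomomorphism = record
      { +-isMonoidHomomorphism = record
        { isMagmaHomomorphism = record
          { isRelHomomorphism = record
            { cong = λ {A} {B} A~B → ≗⇒~ λ ρ →
                trans (⟦τ⟧ A ρ) (trans (~⇒≗ A~B (h ρ)) (sym (⟦τ⟧ B ρ))) }
          ; homo = τ-homo _∘ₗ_ _∨_ ⟦∘ₗ⟧
          }
        ; ε-homo = ≗⇒~ (⟦τ⟧ (1 , θ))
        }
      ; *-homo = τ-homo _·ₗ_ _∧_ ⟦·ₗ⟧
      }
    ; 1#-homo = ≗⇒~ (⟦τ⟧ (1 , 𝟙))
    }

-- Binary codes and the minterms y_k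

open import Data.Nat using (_+_; _*_; _/_; _%_)
open import Data.Nat.Properties using (+-monoˡ-<; *-monoˡ-≤; *-comm; module ≤-Reasoning)
open import Data.Nat.DivMod using ([m+kn]%n≡m%n; m*n/n≡m; +-distrib-/-∣ʳ; m%n<n; m<n*o⇒m/o<n; m≡m%n+[m/n]*n)
open import Data.Nat.Divisibility using (n∣m*n)

digit : Bool → ℕ
digit false = 0
digit true  = 1

fromDigit : ℕ → Bool
fromDigit zero    = false
fromDigit (suc _) = true

fromDigit-digit : ∀ b → fromDigit (digit b) ≡ b
fromDigit-digit false = refl
fromDigit-digit true  = refl

digit-fromDigit : ∀ {m} → m < 2 → digit (fromDigit m) ≡ m
digit-fromDigit {0} _ = refl
digit-fromDigit {1} _ = refl
digit-fromDigit {suc (suc _)} (s≤s (s≤s ()))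

[d+c*2]%2≡d : ∀ b c → (digit b + c * 2) % 2 ≡ digit b
[d+c*2]%2≡d false c = [m+kn]%n≡m%n 0 c 2
[d+c*2]%2≡d true  c = [m+kn]%n≡m%n 1 c 2

[d+c*2]/2≡c : ∀ b c → (digit b + c * 2) / 2 ≡ c
[d+c*2]/2≡c false c = m*n/n≡m c 2
[d+c*2]/2≡c true  c = trans (+-distrib-/-∣ʳ 1 {c * 2} {2} (n∣m*n c)) (m*n/n≡m c 2)

bits : ℕ → Env
bits k n = fromDigit (bit k n)

code : ℕ → Env → ℕ
code zero    ρ = 0
code (suc N) ρ = digit (ρ 0) + code N (ρ ∘′ suc) * 2

code< : ∀ N ρ → code N ρ < 2 ^ N
code< zero    ρ = s≤s z≤n
code< (suc N) ρ = begin-strict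
  digit (ρ 0) + c * 2 <⟨ +-monoˡ-< (c * 2) (digit<2 (ρ 0)) ⟩
  suc c * 2           ≤⟨ *-monoˡ-≤ 2 (code< N (ρ ∘′ suc)) ⟩
  2 ^ N * 2           ≡⟨ *-comm (2 ^ N) 2 ⟩
  2 ^ suc N           ∎
  where
  open ≤-Reasoning
  c : ℕ
  c = code N (ρ ∘′ suc)
  digit<2 : ∀ b → digit b < 2
  digit<2 false = s≤s z≤n
  digit<2 true  = s≤s (s≤s z≤n)

code-local : ∀ N {ρ ρ′} → Agree N ρ ρ′ → code N ρ ≡ code N ρ′
code-local zero    ρ≐ρ′ = refl
code-local (suc N) ρ≐ρ′ =
  cong₂ (λ d c → digit d + c * 2) (ρ≐ρ′ (s≤s z≤n)) (code-local N (ρ≐ρ′ ∘′ s≤s))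

bits-code : ∀ N ρ → Agree N (bits (code N ρ)) ρ
bits-code (suc N) ρ {zero}  _         =
  trans (cong fromDigit ([d+c*2]%2≡d (ρ 0) (code N (ρ ∘′ suc)))) (fromDigit-digit (ρ 0))
bits-code (suc N) ρ {suc n} (s≤s n<N) =
  trans (cong (λ k → bits k n) ([d+c*2]/2≡c (ρ 0) (code N (ρ ∘′ suc)))) (bits-code N (ρ ∘′ suc) n<N)

code-bits : ∀ N {k} → k < 2 ^ N → code N (bits k) ≡ k
code-bits zero    {zero}  _         = refl
code-bits zero    {suc _} (s≤s ())
code-bits (suc N) {k}     k<2^[1+N] = begin
  digit (fromDigit (k % 2)) + code N (bits (k / 2)) * 2
    ≡⟨ cong₂ (λ d c → d + c * 2) (digit-fromDigit (m%n<n k 2)) (code-bits N (m<n*o⇒m/o<n k<2^N*2)) ⟩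
  k % 2 + k / 2 * 2
    ≡⟨ m≡m%n+[m/n]*n k 2 ⟨
  k ∎
  where
  open ≡-Reasoning
  k<2^N*2 : k < 2 ^ N * 2
  k<2^N*2 = subst (k <_) (*-comm 2 (2 ^ N)) k<2^[1+N]

index : (N : ℕ) → Env → Fin (2 ^ N)
index N ρ = fromℕ< (code< N ρ)

index-local : ∀ N {ρ ρ′} → Agree N ρ ρ′ → index N ρ ≡ index N ρ′
index-local N ρ≐ρ′ = fromℕ<-cong _ _ (code-local N ρ≐ρ′) _ _

index-bits : ∀ N (k : Fin (2 ^ N)) → index N (bits (toℕ k)) ≡ k
index-bits N k = toℕ-injective (trans (toℕ-fromℕ< _) (code-bits N (toℕ<n k)))

bits-index : ∀ N ρ → Agree N (bits (toℕ (index N ρ))) ρ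
bits-index N ρ rewrite toℕ-fromℕ< (code< N ρ) = bits-code N ρ

bits-agree⇔index : ∀ N (k : Fin (2 ^ N)) ρ → Agree N (bits (toℕ k)) ρ ⇔ k ≡ index N ρ
bits-agree⇔index N k ρ = mk⇔ (λ (k≐ρ : Agree N _ ρ) → trans (sym (index-bits N k)) (index-local N k≐ρ))
                             (λ { refl → bits-index N ρ })

literal : Bool → Fin N → Term N
literal true  = x
literal false = xc

⟦literal⟧ : ∀ b (l : Fin N) ρ → ⟦ literal b l ⟧ ρ ≡ true ⇔ b ≡ ρ (toℕ l)
⟦literal⟧ true  l ρ = mk⇔ sym sym
⟦literal⟧ false l ρ with ρ (toℕ l)
... | true  = mk⇔ (λ ()) (λ ())
... | false = mk⇔ (const refl) (const refl)

-- The literals of y are a local function of Defs, reachable only through this projection.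
private
  y-factors : ∀ N k → Σ (Fin N → Term N) λ lit → y N k ≡ foldr (λ l t → lit l · t) 𝟙 (allFin N)
  y-factors N k = _ , refl

  y-factor≡literal : ∀ N k l → proj₁ (y-factors N k) l ≡ literal (bits (toℕ k) (toℕ l)) l
  y-factor≡literal N k l with bit (toℕ k) (toℕ l)
  ... | zero  = refl
  ... | suc _ = refl

y≡∏literal : ∀ N k → y N k ≡ foldr (λ l t → literal (bits (toℕ k) (toℕ l)) l · t) 𝟙 (allFin N)
y≡∏literal N k = foldr-cong (λ l t → cong (_· t) (y-factor≡literal N k l)) refl (allFin N)

⟦∏⟧ : ∀ {A : Set} (g : A → Term N) (ls : List A) ρ →
      ⟦ foldr (λ l t → g l · t) 𝟙 ls ⟧ ρ ≡ true ⇔ All (λ l → ⟦ g l ⟧ ρ ≡ true) ls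
⟦∏⟧ g []       ρ = mk⇔ (const []) (const refl)
⟦∏⟧ g (l ∷ ls) ρ = mk⇔
  (λ gl∧rest → ∧-conicalˡ _ _ gl∧rest ∷ Equivalence.to (⟦∏⟧ g ls ρ) (∧-conicalʳ _ _ gl∧rest))
  (λ { (gl ∷ rest) → cong₂ _∧_ gl (Equivalence.from (⟦∏⟧ g ls ρ) rest) })

⟦y⟧ : ∀ N (k : Fin (2 ^ N)) ρ → ⟦ y N k ⟧ ρ ≡ true ⇔ (∀ l → bits (toℕ k) (toℕ l) ≡ ρ (toℕ l))
⟦y⟧ N k ρ rewrite y≡∏literal N k = mk⇔
  (λ y≡true l → to (⟦literal⟧ _ l ρ) (tabulate⁻ (to (⟦∏⟧ _ (allFin N) ρ) y≡true) l))
  (λ k≐ρ → from (⟦∏⟧ _ (allFin N) ρ) (tabulate⁺ λ l → from (⟦literal⟧ _ l ρ) (k≐ρ l)))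
  where open Equivalence

⟦y⟧⇔index : ∀ N (k : Fin (2 ^ N)) ρ → ⟦ y N k ⟧ ρ ≡ true ⇔ k ≡ index N ρ
⟦y⟧⇔index N k ρ = ⇔-trans (⟦y⟧ N k ρ) (⇔-trans (⇔-sym Agree⇔∀Fin) (bits-agree⇔index N k ρ))

override : ℕ → Env → Env → Env
override N σ ρ n = if n <ᵇ N then σ n else ρ n

override-agree : ∀ N σ ρ → Agree N (override N σ ρ) σ
override-agree N σ ρ {n} n<N with n <ᵇ N | <⇒<ᵇ n<N
... | true | _ = refl

override-local : ∀ N σ {ρ ρ′} → Agree M ρ ρ′ → Agree M (override N σ ρ) (override N σ ρ′)
override-local N σ ρ≐ρ′ {n} n<M with n <ᵇ N
... | true  = refl
... | false = ρ≐ρ′ n<M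

module Relabel (N : ℕ) (π : Permutation′ (2 ^ N)) where

  πbits : Env → Env
  πbits ρ = bits (toℕ (π ⟨$⟩ˡ index N ρ))

  relabel : Env → Env
  relabel ρ = override N (πbits ρ) ρ

  relabel-local : ∀ {M ρ ρ′} → N ≤ M → Agree M ρ ρ′ → Agree M (relabel ρ) (relabel ρ′)
  relabel-local N≤M ρ≐ρ′ rewrite index-local N (Agree-≤ N≤M ρ≐ρ′) =
    override-local N (πbits _) ρ≐ρ′

  ≡π⁻¹⇔π≡ : ∀ {i j} → i ≡ π ⟨$⟩ˡ j ⇔ π ⟨$⟩ʳ i ≡ j
  ≡π⁻¹⇔π≡ = mk⇔ (Inverse.inverseˡ π) (λ πi≡j → sym (Inverse.inverseʳ π (sym πi≡j)))

  index-relabel : ∀ ρ → index N (relabel ρ) ≡ π ⟨$⟩ˡ index N ρ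
  index-relabel ρ = trans (index-local N (override-agree N (πbits ρ) ρ)) (index-bits N _)

  ⟦y⟧-relabel : ∀ i ρ → ⟦ y N i ⟧ (relabel ρ) ≡ ⟦ y N (π ⟨$⟩ʳ i) ⟧ ρ
  ⟦y⟧-relabel i ρ = ⇔→≡ (begin
    ⟦ y N i ⟧ (relabel ρ) ≡ true   ≈⟨ ⟦y⟧⇔index N i (relabel ρ) ⟩
    i ≡ index N (relabel ρ)        ≡⟨ cong (i ≡_) (index-relabel ρ) ⟩
    i ≡ π ⟨$⟩ˡ index N ρ           ≈⟨ ≡π⁻¹⇔π≡ ⟩
    π ⟨$⟩ʳ i ≡ index N ρ           ≈⟨ ⟦y⟧⇔index N (π ⟨$⟩ʳ i) ρ ⟨
    ⟦ y N (π ⟨$⟩ʳ i) ⟧ ρ ≡ true    ∎)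
    where open import Relation.Binary.Reasoning.Setoid (⇔-setoid 0ℓ)

lemma4p3 : (N : ℕ) → 1 ≤ N → (π : Permutation′ (2 ^ N)) →
    ∃ λ (τ : ScX → ScX) → IsSemiringHomomorphism τ ×
      ((i : Fin (2 ^ N)) → τ (N , y N i) ~ (N , y N (π ⟨$⟩ʳ i)))
lemma4p3 N _ π =
  τ , τ-isSemiringHomomorphism , λ i → ≗⇒~ λ ρ → trans (⟦τ⟧ (N , y N i) ρ) (⟦y⟧-relabel i ρ)
  where
  open Relabel N π
  open Pullback N relabel relabel-local
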